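{- Let $G=(V,E,\mathsf{w})$ be a vertex-weighted graph with $\mathsf{w}\colon V\to\mathbb{Z}^{+}$ and let $k$ be an integer. If $G$ has a $\mathrm{wvi}(k)$-set, then $G$ has an irredundant $\mathrm{wvi}(k)$-set.
   Context: For $X\subseteq V$ write $\mathsf{w}(X)=\sum_{v\in X}\mathsf{w}(v)$. For $S\subseteq V$, $G-S$ is the graph obtained by deleting $S$, and $\mathrm{cc}(G-S)$ is its set of connected components (a maximum over the empty set is taken to be $0$). A set $S\subseteq V$ is a $\mathrm{wvi}(k)$-set if $\mathsf{w}(S)+\max_{C\in\mathrm{cc}(G-S)}\mathsf{w}(V(C))\le k$. A vertex $v\in S$ is redundant (with respect to $S$) if at most one connected component of $G-S$ contains a neighbor of $v$; $S$ is irredundant if it contains no redundant vertex. -}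

module Defs where

open import Data.Nat using (ℕ; zero; suc; _+_; _<_)
open import Data.Integer using (ℤ; +_) renaming (_≤_ to _≤ℤ_)
open import Data.Bool using (Bool; true; false; if_then_else_)
open import Data.Fin using (Fin)
open import Data.Fin.Subset using (Subset; _∈_; _∉_; _⊆_)
open import Data.Vec using (lookup; tabulate)
open import Data.Vec using () renaming (sum to vsum)
open import Data.Product using (Σ; _×_; ∃-syntax)
open import Relation.Binary.PropositionalEquality using (_≡_)
open import Relation.Nullary using (¬_)

record WGraph (n : ℕ) : Set where
  field
    adj       : Fin n → Fin n → Bool
    adj-sym   : ∀ u v → adj u v ≡ adj v u
    adj-irr   : ∀ v → adj v v ≡ false
    w         : Fin n → ℕ
    w-pos     : ∀ v → 0 < w v

module _ {n : ℕ} (G : WGraph n) where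
  open WGraph G

  Adj : Fin n → Fin n → Set
  Adj u v = adj u v ≡ true

  wt : Subset n → ℕ
  wt X = vsum (tabulate (λ i → if lookup X i then w i else 0))

  data PathIn (C : Subset n) : Fin n → Fin n → Set where
    here : ∀ {x} → x ∈ C → PathIn C x x
    step : ∀ {x y z} → x ∈ C → Adj x y → PathIn C y z → PathIn C x z

  -- C is (the vertex set of) a connected component of G - S
  IsComponent : Subset n → Subset n → Set
  IsComponent S C =
      (∃[ v ] v ∈ C)
    × (∀ v → v ∈ C → v ∉ S)
    × (∀ x y → x ∈ C → y ∈ C → PathIn C x y)
    × (∀ x y → x ∈ C → Adj x y → y ∉ S → y ∈ C)

  -- S is a wvi(k)-set: w(S) + max_{C ∈ cc(G-S)} w(C) ≤ k  (max over ∅ is 0)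
  IsWVI : ℤ → Subset n → Set
  IsWVI k S =
      (+ wt S ≤ℤ k)
    × (∀ C → IsComponent S C → + (wt S + wt C) ≤ℤ k)

  Redundant : Subset n → Fin n → Set
  Redundant S v =
    ∀ C₁ C₂ → IsComponent S C₁ → IsComponent S C₂
    → (∃[ x ] (x ∈ C₁ × Adj v x)) → (∃[ y ] (y ∈ C₂ × Adj v y))
    → C₁ ≡ C₂

  Irredundant : Subset n → Set
  Irredundant S = ∀ v → v ∈ S → ¬ Redundant S v

-- Deleting a redundant vertex v from a wvi(k)-set S keeps it a wvi(k)-set and strictly lowers
-- its weight, so repeating this terminates in an irredundant wvi(k)-set.  Components of G - S
-- avoiding v are unchanged; all neighbours of v outside S lie in one component D of G - S, so
-- the component C of G - (S - v) through v lies in D ∪ {v}, whence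
-- w(S - v) + w(C) ≤ w(S) + w(D) ≤ k (or w(S - v) + w(C) ≤ w(S) ≤ k if D does not exist).
module Submission where

open import Defs
open import Function using (_∘_)
open import Data.Nat using (ℕ; zero; suc; _+_; _≤_; _<_; z≤n)
open import Data.Nat.Properties
  using (≤-refl; ≤-reflexive; ≤-trans; +-mono-≤; +-mono-<-≤; +-mono-≤-<; +-monoˡ-≤; +-suc;
         +-identityʳ; <⇒≤; <⇒≱; m≤m+n; m≤n+m; +-commutativeSemigroup)
open import Algebra.Properties.CommutativeSemigroup +-commutativeSemigroup using (interchange)
open import Data.Nat.Induction using (<-wellFounded)
open import Induction.WellFounded using (Acc; acc)
open import Data.Integer using (ℤ; +_; +≤+) renaming (_≤_ to _≤ℤ_)
open import Data.Integer.Properties using () renaming (≤-trans to ≤ℤ-trans)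
open import Data.Bool using (true; false; if_then_else_)
open import Data.Bool.Properties using () renaming (_≟_ to _≟ᵇ_)
open import Data.Fin using (Fin; zero; suc; _≟_)
open import Data.Fin.Properties using (any?; all?)
open import Data.Fin.Subset using (Subset; _∈_; _∉_; _⊆_; _⊂_; _∪_; ⁅_⁆; _-_; ∣_∣)
open import Data.Fin.Subset.Properties
  using (_∈?_; x∈p∪q⁺; x∈p∪q⁻; p⊆p∪q; q⊆p∪q; x∈⁅x⁆; x∈⁅y⁆⇒x≡y; p─q⊆p;
         x∈p∧x≢y⇒x∈p-y; x∈p⇒p-x⊂p; p⊂q⇒∣p∣<∣q∣; ∣p∣≤n)
open import Data.Vec using (lookup; tabulate)
open import Data.Vec using () renaming (sum to vsum)
open import Data.Vec.Properties using ([]=⇒lookup; lookup⇒[]=)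
open import Data.Product using (_×_; _,_; proj₁; proj₂; ∃-syntax)
open import Data.Sum using (_⊎_; inj₁; inj₂)
open import Data.Empty using (⊥; ⊥-elim)
open import Relation.Nullary using (Dec; yes; no)
open import Relation.Nullary.Decidable using (_×-dec_; _→-dec_; ¬?)
open import Relation.Binary.PropositionalEquality
  using (_≡_; _≢_; refl; sym; trans; cong; subst; subst₂; module ≡-Reasoning)

sum-tabulate-mono-≤ : ∀ {n} {f g : Fin n → ℕ} → (∀ i → f i ≤ g i) →
                      vsum (tabulate f) ≤ vsum (tabulate g)
sum-tabulate-mono-≤ {zero}  f≤g = z≤n
sum-tabulate-mono-≤ {suc n} f≤g = +-mono-≤ (f≤g zero) (sum-tabulate-mono-≤ (f≤g ∘ suc))

sum-tabulate-mono-< : ∀ {n} {f g : Fin n → ℕ} → (∀ i → f i ≤ g i) → ∀ i → f i < g i →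
                      vsum (tabulate f) < vsum (tabulate g)
sum-tabulate-mono-< f≤g zero    fi<gi = +-mono-<-≤ fi<gi (sum-tabulate-mono-≤ (f≤g ∘ suc))
sum-tabulate-mono-< f≤g (suc i) fi<gi =
  +-mono-≤-< (f≤g zero) (sum-tabulate-mono-< (f≤g ∘ suc) i fi<gi)

sum-tabulate-+ : ∀ {n} (f g : Fin n → ℕ) →
                 vsum (tabulate (λ i → f i + g i)) ≡ vsum (tabulate f) + vsum (tabulate g)
sum-tabulate-+ {zero}  f g = refl
sum-tabulate-+ {suc n} f g = begin
  (f zero + g zero) + vsum (tabulate (λ i → f (suc i) + g (suc i)))
    ≡⟨ cong (λ s → f zero + g zero + s) (sum-tabulate-+ (f ∘ suc) (g ∘ suc)) ⟩
  (f zero + g zero) + (vsum (tabulate (f ∘ suc)) + vsum (tabulate (g ∘ suc)))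
    ≡⟨ interchange (f zero) (g zero) _ _ ⟩
  (f zero + vsum (tabulate (f ∘ suc))) + (g zero + vsum (tabulate (g ∘ suc)))
    ∎
  where open ≡-Reasoning

x∉p-y∧x≢y⇒x∉p : ∀ {n} {p : Subset n} {x y} → x ∉ p - y → x ≢ y → x ∉ p
x∉p-y∧x≢y⇒x∉p x∉p-y x≢y x∈p = x∉p-y (x∈p∧x≢y⇒x∈p-y x∈p x≢y)

x∉p∧x∉q⇒x∉p∪q : ∀ {n} {p q : Subset n} {x} → x ∉ p → x ∉ q → x ∉ p ∪ q
x∉p∧x∉q⇒x∉p∪q {p = p} {q} x∉p x∉q x∈p∪q with x∈p∪q⁻ p q x∈p∪q
... | inj₁ x∈p = x∉p x∈p
... | inj₂ x∈q = x∉q x∈q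

module Weight {n : ℕ} (w : Fin n → ℕ) where

  weightAt : Subset n → Fin n → ℕ
  weightAt X i = if lookup X i then w i else 0

  -- Definitionally `wt G X` when `w` is the weight function of `G`.
  weight : Subset n → ℕ
  weight X = vsum (tabulate (weightAt X))

  weightAt-∈ : ∀ {X i} → i ∈ X → weightAt X i ≡ w i
  weightAt-∈ i∈X rewrite []=⇒lookup i∈X = refl

  weightAt-∉ : ∀ {X i} → i ∉ X → weightAt X i ≡ 0
  weightAt-∉ {X} {i} i∉X with lookup X i in eq
  ... | true  = ⊥-elim (i∉X (lookup⇒[]= i X eq))
  ... | false = refl

  weightAt-mono : ∀ {X Y} → X ⊆ Y → ∀ i → weightAt X i ≤ weightAt Y i
  weightAt-mono {X} X⊆Y i with i ∈? X
  ... | yes i∈X rewrite weightAt-∈ i∈X | weightAt-∈ (X⊆Y i∈X) = ≤-refl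
  ... | no  i∉X rewrite weightAt-∉ i∉X = z≤n

  weight-mono : ∀ {X Y} → X ⊆ Y → weight X ≤ weight Y
  weight-mono X⊆Y = sum-tabulate-mono-≤ (weightAt-mono X⊆Y)

  weight-mono-< : (∀ i → 0 < w i) → ∀ {X Y} → X ⊂ Y → weight X < weight Y
  weight-mono-< w-pos (X⊆Y , i , i∈Y , i∉X) =
    sum-tabulate-mono-< (weightAt-mono X⊆Y) i
      (subst₂ _<_ (sym (weightAt-∉ i∉X)) (sym (weightAt-∈ i∈Y)) (w-pos i))

  weight-∪-≤ : ∀ X Y → weight (X ∪ Y) ≤ weight X + weight Y
  weight-∪-≤ X Y = subst (weight (X ∪ Y) ≤_) (sum-tabulate-+ (weightAt X) (weightAt Y))
                         (sum-tabulate-mono-≤ pointwise)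
    where
    pointwise : ∀ i → weightAt (X ∪ Y) i ≤ weightAt X i + weightAt Y i
    pointwise i with i ∈? X | i ∈? Y
    ... | yes i∈X | _ rewrite weightAt-∈ (x∈p∪q⁺ {q = Y} (inj₁ i∈X)) | weightAt-∈ i∈X = m≤m+n _ _
    ... | no i∉X | yes i∈Y rewrite weightAt-∈ (x∈p∪q⁺ {p = X} (inj₂ i∈Y)) | weightAt-∉ i∉X
                                 | weightAt-∈ i∈Y = ≤-refl
    ... | no i∉X | no i∉Y rewrite weightAt-∉ (x∉p∧x∉q⇒x∉p∪q {p = X} i∉X i∉Y) = z≤n

  weight-disjoint-+ : ∀ {X Y} → (∀ {i} → i ∈ X → i ∉ Y) → weight X + weight Y ≤ weight (X ∪ Y)
  weight-disjoint-+ {X} {Y} disjoint =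
    subst (_≤ weight (X ∪ Y)) (sum-tabulate-+ (weightAt X) (weightAt Y))
          (sum-tabulate-mono-≤ pointwise)
    where
    pointwise : ∀ i → weightAt X i + weightAt Y i ≤ weightAt (X ∪ Y) i
    pointwise i with i ∈? X
    ... | yes i∈X rewrite weightAt-∈ i∈X | weightAt-∉ (disjoint i∈X)
                        | weightAt-∈ (x∈p∪q⁺ {q = Y} (inj₁ i∈X)) = ≤-reflexive (+-identityʳ _)
    ... | no  i∉X rewrite weightAt-∉ i∉X = weightAt-mono (q⊆p∪q X Y) i

  weight-disjoint-cover : ∀ {X Y Z} → (∀ {i} → i ∈ X → i ∉ Y) → X ∪ Y ⊆ Z →
                          weight X + weight Y ≤ weight Z
  weight-disjoint-cover disjoint cover = ≤-trans (weight-disjoint-+ disjoint) (weight-mono cover)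

module _ {n : ℕ} (G : WGraph n) where
  open WGraph G
  open Weight w

  Adj-sym : ∀ {u v} → Adj G u v → Adj G v u
  Adj-sym {u} {v} u~v = trans (adj-sym v u) u~v

  pathIn-mono : ∀ {C D a b} → C ⊆ D → PathIn G C a b → PathIn G D a b
  pathIn-mono C⊆D (here a∈C)       = here (C⊆D a∈C)
  pathIn-mono C⊆D (step a∈C a~ p) = step (C⊆D a∈C) a~ (pathIn-mono C⊆D p)

  pathIn-snoc : ∀ {C a b c} → PathIn G C a b → c ∈ C → Adj G b c → PathIn G C a c
  pathIn-snoc (here a∈C)       c∈C b~c = step a∈C b~c (here c∈C)
  pathIn-snoc (step a∈C a~ p) c∈C b~c = step a∈C a~ (pathIn-snoc p c∈C b~c)

  pathIn-reverse : ∀ {C a b} → PathIn G C a b → PathIn G C b a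
  pathIn-reverse (here a∈C)         = here a∈C
  pathIn-reverse (step a∈C a~a′ p) = pathIn-snoc (pathIn-reverse p) a∈C (Adj-sym a~a′)

  pathIn-++ : ∀ {C a b c} → PathIn G C a b → PathIn G C b c → PathIn G C a c
  pathIn-++ (here _)         q = q
  pathIn-++ (step a∈C a~ p) q = step a∈C a~ (pathIn-++ p q)

  pathIn-backward-ind : ∀ {C v} (P : Fin n → Set) →
    (∀ {i} → i ∈ C → i ≢ v → Adj G i v → P i) →
    (∀ {i j} → i ∈ C → i ≢ v → Adj G i j → P j → P i) →
    ∀ {u} → PathIn G C u v → u ≢ v → P u
  pathIn-backward-ind P last back (here _) u≢v = ⊥-elim (u≢v refl)
  pathIn-backward-ind {v = v} P last back (step {y = j} u∈C u~j p) u≢v with j ≟ v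
  ... | yes refl = last u∈C u≢v u~j
  ... | no  j≢v  = back u∈C u≢v u~j (pathIn-backward-ind P last back p j≢v)

  Closed : Subset n → Subset n → Set
  Closed S R = ∀ u i → u ∈ R → Adj G u i → i ∉ S → i ∈ R

  module ComponentOf (S : Subset n) (x : Fin n) where

    -- Invariant of the search for the component of x in G - S.
    Grown : Subset n → Set
    Grown R = x ∈ R × (∀ {u} → u ∈ R → PathIn G R u x) × (∀ {u} → u ∈ R → u ≡ x ⊎ u ∉ S)

    Frontier : Subset n → Fin n → Set
    Frontier R i = i ∉ R × i ∉ S × ∃[ u ] (u ∈ R × Adj G u i)

    frontier? : ∀ R i → Dec (Frontier R i)
    frontier? R i = ¬? (i ∈? R) ×-dec ¬? (i ∈? S) ×-dec any? (λ u → u ∈? R ×-dec adj u i ≟ᵇ true)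

    grown-⁅x⁆ : Grown ⁅ x ⁆
    grown-⁅x⁆ = x∈⁅x⁆ x , toX , inj₁ ∘ x∈⁅y⁆⇒x≡y x
      where
      toX : ∀ {u} → u ∈ ⁅ x ⁆ → PathIn G ⁅ x ⁆ u x
      toX u∈ with x∈⁅y⁆⇒x≡y x u∈
      ... | refl = here u∈

    grown-extend : ∀ {R i} → Grown R → Frontier R i → Grown (R ∪ ⁅ i ⁆)
    grown-extend {R} {i} (x∈R , toX , avoid) (_ , i∉S , u , u∈R , u~i) =
      R⊆ x∈R , toX′ , avoid′
      where
      R⊆ : R ⊆ R ∪ ⁅ i ⁆
      R⊆ = p⊆p∪q ⁅ i ⁆
      toX′ : ∀ {j} → j ∈ R ∪ ⁅ i ⁆ → PathIn G (R ∪ ⁅ i ⁆) j x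
      toX′ j∈ with x∈p∪q⁻ R ⁅ i ⁆ j∈
      ... | inj₁ j∈R = pathIn-mono R⊆ (toX j∈R)
      ... | inj₂ j∈i with x∈⁅y⁆⇒x≡y i j∈i
      ...   | refl = step j∈ (Adj-sym u~i) (pathIn-mono R⊆ (toX u∈R))
      avoid′ : ∀ {j} → j ∈ R ∪ ⁅ i ⁆ → j ≡ x ⊎ j ∉ S
      avoid′ j∈ with x∈p∪q⁻ R ⁅ i ⁆ j∈
      ... | inj₁ j∈R = avoid j∈R
      ... | inj₂ j∈i with x∈⁅y⁆⇒x≡y i j∈i
      ...   | refl = inj₂ i∉S

    frontier-grows : ∀ {R i} → Frontier R i → ∣ R ∣ < ∣ R ∪ ⁅ i ⁆ ∣
    frontier-grows {R} {i} (i∉R , _) =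
      p⊂q⇒∣p∣<∣q∣ (p⊆p∪q ⁅ i ⁆ , i , x∈p∪q⁺ (inj₂ (x∈⁅x⁆ i)) , i∉R)

    -- Each extension adds a vertex, so `n ≤ ∣ R ∣ + fuel` makes the fuel sufficient.
    grow : ∀ fuel R → n ≤ ∣ R ∣ + fuel → Grown R → ∃[ R′ ] (Grown R′ × Closed S R′)
    grow fuel R bound grown with any? (frontier? R)
    ... | no noFrontier = R , grown , closed
      where
      closed : Closed S R
      closed u i u∈R u~i i∉S with i ∈? R
      ... | yes i∈R = i∈R
      ... | no  i∉R = ⊥-elim (noFrontier (i , i∉R , i∉S , u , u∈R , u~i))
    grow zero R bound grown | yes (i , front) =
      ⊥-elim (<⇒≱ (≤-trans (frontier-grows front) (∣p∣≤n (R ∪ ⁅ i ⁆)))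
                  (subst (n ≤_) (+-identityʳ ∣ R ∣) bound))
    grow (suc fuel) R bound grown | yes (i , front) =
      grow fuel (R ∪ ⁅ i ⁆) bound′ (grown-extend grown front)
      where
      bound′ : n ≤ ∣ R ∪ ⁅ i ⁆ ∣ + fuel
      bound′ = ≤-trans bound (≤-trans (≤-reflexive (+-suc ∣ R ∣ fuel))
                                      (+-monoˡ-≤ fuel (frontier-grows front)))

    component : ∃[ R ] (Grown R × Closed S R)
    component = grow n ⁅ x ⁆ (m≤n+m n _) grown-⁅x⁆

  componentOf : Subset n → Fin n → Subset n
  componentOf S x = proj₁ (ComponentOf.component S x)

  x∈componentOf : ∀ S x → x ∈ componentOf S x
  x∈componentOf S x = proj₁ (proj₁ (proj₂ (ComponentOf.component S x)))

  componentOf-closed : ∀ S x → Closed S (componentOf S x)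
  componentOf-closed S x = proj₂ (proj₂ (ComponentOf.component S x))

  componentOf-isComponent : ∀ S x → x ∉ S → IsComponent G S (componentOf S x)
  componentOf-isComponent S x x∉S =
    (x , x∈componentOf S x) , avoid′ , connected , componentOf-closed S x
    where
    grown = proj₁ (proj₂ (ComponentOf.component S x))
    avoid′ : ∀ u → u ∈ componentOf S x → u ∉ S
    avoid′ u u∈ with proj₂ (proj₂ grown) u∈
    ... | inj₁ refl = x∉S
    ... | inj₂ u∉S  = u∉S
    connected : ∀ a b → a ∈ componentOf S x → b ∈ componentOf S x → PathIn G (componentOf S x) a b
    connected a b a∈ b∈ = pathIn-++ (proj₁ (proj₂ grown) a∈) (pathIn-reverse (proj₁ (proj₂ grown) b∈))

  -- A decidable consequence of redundancy.
  NeighboursConnected : Subset n → Fin n → Set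
  NeighboursConnected S v =
    ∀ x y → Adj G v x → x ∉ S → Adj G v y → y ∉ S → y ∈ componentOf S x

  neighboursConnected? : ∀ S v → Dec (NeighboursConnected S v)
  neighboursConnected? S v = all? λ x → all? λ y →
    adj v x ≟ᵇ true →-dec ¬? (x ∈? S) →-dec adj v y ≟ᵇ true →-dec ¬? (y ∈? S) →-dec
    y ∈? componentOf S x

  redundant⇒neighboursConnected : ∀ {S v} → Redundant G S v → NeighboursConnected S v
  redundant⇒neighboursConnected {S} red x y v~x x∉S v~y y∉S =
    subst (y ∈_) (sym sameComponent) (x∈componentOf S y)
    where
    sameComponent : componentOf S x ≡ componentOf S y
    sameComponent = red _ _ (componentOf-isComponent S x x∉S) (componentOf-isComponent S y y∉S)
                        (x , x∈componentOf S x , v~x) (y , x∈componentOf S y , v~y)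

  isComponent-disjoint : ∀ {S C} → IsComponent G S C → ∀ {i} → i ∈ S → i ∉ C
  isComponent-disjoint (_ , avoid , _) i∈S i∈C = avoid _ i∈C i∈S

  isComponent-minus : ∀ {S v C} → IsComponent G (S - v) C → v ∉ C → IsComponent G S C
  isComponent-minus {S} {v} (nonempty , avoid , connected , closed) v∉C =
    nonempty , avoid′ , connected , λ a b a∈C a~b b∉S → closed a b a∈C a~b (b∉S ∘ p─q⊆p S ⁅ v ⁆)
    where
    avoid′ : ∀ u → u ∈ _ → u ∉ S
    avoid′ u u∈C = x∉p-y∧x≢y⇒x∉p (avoid u u∈C) λ { refl → v∉C u∈C }

  module ComponentThroughRemoved {S v C} (isC : IsComponent G (S - v) C) (v∈C : v ∈ C) where

    ∉S : ∀ {i} → i ∈ C → i ≢ v → i ∉ S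
    ∉S i∈C = x∉p-y∧x≢y⇒x∉p (proj₁ (proj₂ isC) _ i∈C)

    pathTo-v : ∀ {u} → u ∈ C → PathIn G C u v
    pathTo-v u∈C = proj₁ (proj₂ (proj₂ isC)) _ _ u∈C v∈C

    ⊆componentOf : NeighboursConnected S v → ∀ {y} → Adj G v y → y ∉ S →
                   ∀ {u} → u ∈ C → u ≢ v → u ∈ componentOf S y
    ⊆componentOf connected {y} v~y y∉S u∈C =
      pathIn-backward-ind (_∈ componentOf S y)
        (λ i∈C i≢v i~v → connected y _ v~y y∉S (Adj-sym i~v) (∉S i∈C i≢v))
        (λ i∈C i≢v i~j j∈D → componentOf-closed S y _ _ j∈D (Adj-sym i~j) (∉S i∈C i≢v))
        (pathTo-v u∈C)

    ⊆⁅v⁆ : (∀ {y} → Adj G v y → y ∉ S → ⊥) → ∀ {u} → u ∈ C → u ≡ v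
    ⊆⁅v⁆ isolated {u} u∈C with u ≟ v
    ... | yes u≡v = u≡v
    ... | no  u≢v = ⊥-elim (pathIn-backward-ind (λ _ → ⊥)
                              (λ i∈C i≢v i~v → isolated (Adj-sym i~v) (∉S i∈C i≢v))
                              (λ _ _ _ contradiction → contradiction)
                              (pathTo-v u∈C) u≢v)

  wt-minus-< : ∀ {S v} → v ∈ S → wt G (S - v) < wt G S
  wt-minus-< v∈S = weight-mono-< w-pos (x∈p⇒p-x⊂p v∈S)

  wvi-minus : ∀ {k S v} → v ∈ S → NeighboursConnected S v → IsWVI G k S → IsWVI G k (S - v)
  wvi-minus {k} {S} {v} v∈S connected (wS≤k , componentsBound) =
    ≤ℤ-trans (+≤+ (<⇒≤ (wt-minus-< v∈S))) wS≤k , bound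
    where
    T⊆S : S - v ⊆ S
    T⊆S = p─q⊆p S ⁅ v ⁆

    bound : ∀ C → IsComponent G (S - v) C → + (wt G (S - v) + wt G C) ≤ℤ k
    bound C isC with v ∈? C
    ... | no v∉C = ≤ℤ-trans (+≤+ (+-monoˡ-≤ (wt G C) (<⇒≤ (wt-minus-< v∈S))))
                            (componentsBound C (isComponent-minus isC v∉C))
    ... | yes v∈C with any? (λ y → adj v y ≟ᵇ true ×-dec ¬? (y ∈? S))
    ...   | yes (y , v~y , y∉S) =
            ≤ℤ-trans (+≤+ (≤-trans (weight-disjoint-cover (isComponent-disjoint isC) cover) (weight-∪-≤ S D)))
                     (componentsBound D (componentOf-isComponent S y y∉S))
      where
      open ComponentThroughRemoved isC v∈C
      D = componentOf S y
      cover : (S - v) ∪ C ⊆ S ∪ D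
      cover {u} u∈ with x∈p∪q⁻ (S - v) C u∈ | u ≟ v
      ... | inj₁ u∈T | _        = p⊆p∪q D (T⊆S u∈T)
      ... | inj₂ _   | yes refl = p⊆p∪q D v∈S
      ... | inj₂ u∈C | no u≢v   = q⊆p∪q S D (⊆componentOf connected v~y y∉S u∈C u≢v)
    ...   | no noNeighbour =
            ≤ℤ-trans (+≤+ (weight-disjoint-cover (isComponent-disjoint isC) cover)) wS≤k
      where
      open ComponentThroughRemoved isC v∈C
      cover : (S - v) ∪ C ⊆ S
      cover {u} u∈ with x∈p∪q⁻ (S - v) C u∈
      ... | inj₁ u∈T = T⊆S u∈T
      ... | inj₂ u∈C with ⊆⁅v⁆ (λ {y} v~y y∉S → noNeighbour (y , v~y , y∉S)) u∈C
      ...   | refl = v∈S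

  irredundant-wvi : ∀ {k} S → Acc _<_ (wt G S) → IsWVI G k S →
                    ∃[ S′ ] (IsWVI G k S′ × Irredundant G S′)
  irredundant-wvi S (acc smaller) wvi with any? (λ v → v ∈? S ×-dec neighboursConnected? S v)
  ... | yes (v , v∈S , connected) =
        irredundant-wvi (S - v) (smaller (wt-minus-< v∈S)) (wvi-minus v∈S connected wvi)
  ... | no none = S , wvi , λ v v∈S red → none (v , v∈S , redundant⇒neighboursConnected red)

corollary2p3 : ∀ {n : ℕ} (G : WGraph n) (k : ℤ)
    → ∃[ S ] IsWVI G k S
    → ∃[ S ] (IsWVI G k S × Irredundant G S)
corollary2p3 G k (S , wvi) = irredundant-wvi G S (<-wellFounded (wt G S)) wvi
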